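{- Let $m\geq 0$ and $n\geq1$ be integers, let $2\leq r\leq n+m$, and let $c\in\mathcal{C}_{n,m}$. Then $$\overline U_r(\beta_r(c))=\overline U_{r-1}(c)\quad\text{and}\quad \overline U_r(c)=\overline U_{r-1}(\beta_r(c)).$$
   Context: $\mathcal{C}_{n,m}$ is the set of column-strict plane partitions $c=(c_{ij})$ (arrays of positive integers of partition shape, weakly decreasing along rows, strictly decreasing down columns) having at most $n$ columns and such that every part in the $j$-th column is $\leq n+m-j$. A part in column $j$ equal to $n+m-j$ is called saturated. For $r\geq1$, $\overline U_r(c)=\#\{(i,j):c_{ij}=r\}+\#\{1\leq k<r: c_{1,n+m-k}=k\}$. The twisted Bender–Knuth involution $\beta_r$ ($2\le r\le n+m$) is defined as follows: in $c$ consider the entries equal to $r$ or $r-1$; ignore every column containing both an $r$ and an $r-1$, and ignore an entry $r-1$ lying in column $n+m-r+1$ (a saturated $r-1$). In each row the remaining such entries consist of some number $k$ of $r$'s immediately followed by some number $l$ of $(r-1)$'s; $\beta_r(c)$ is obtained by replacing them, in every row, by $l$ entries $r$ followed by $k$ entries $r-1$, all other entries being unchanged. Then $\beta_r(c)\in\mathcal{C}_{n,m}$. -}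

module Defs where

open import Data.Nat using (ℕ; zero; suc; _+_; _∸_; _≤_; _<_; _≡ᵇ_; _<ᵇ_)
open import Data.Bool using (Bool; true; false; if_then_else_; _∧_; _∨_; not)
open import Data.Sum using (_⊎_)
open import Relation.Binary.PropositionalEquality using (_≡_)

-- A plane partition is encoded as a function  c i j  (row i, column j, both
-- 0-indexed, i.e. c i j is the paper's c_{i+1,j+1}); the value 0 means
-- "no cell here" (all genuine parts are positive integers).
PP : Set
PP = ℕ → ℕ → ℕ

count : ℕ → (ℕ → Bool) → ℕ
count zero    p = 0
count (suc N) p = count N p + (if p N then 1 else 0)

sumTo : ℕ → (ℕ → ℕ) → ℕ
sumTo zero    f = 0
sumTo (suc N) f = sumTo N f + f N

record IsC (n m : ℕ) (c : PP) : Set where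
  field
    -- rows weakly decreasing (with 0 = empty this also makes rows left-justified)
    rowDecr     : ∀ i j → c i (suc j) ≤ c i j
    -- columns strictly decreasing (cells below an empty cell are empty)
    colStrict   : ∀ i j → c (suc i) j ≡ 0 ⊎ c (suc i) j < c i j
    atMostNCols : ∀ i j → n ≤ j → c i j ≡ 0
    bound       : ∀ i j → c i j ≤ n + m ∸ suc j

-- Ū_r(c) = #{(i,j) : c_ij = r} + #{1 ≤ k < r : c_{1,n+m-k} = k}.
-- For c ∈ C_{n,m} every cell lies in a row < n+m and a column < n, so the
-- first count ranges over exactly all cells.
Ubar : (n m r : ℕ) → PP → ℕ
Ubar n m r c =
  sumTo (n + m) (λ i → count n (λ j → c i j ≡ᵇ r))
  + count r (λ k → not (k ≡ᵇ 0) ∧ (c 0 (n + m ∸ suc k) ≡ᵇ k))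

colHas : PP → ℕ → ℕ → ℕ → Bool
colHas c N j v = anyTo N
  where
  anyTo : ℕ → Bool
  anyTo zero    = false
  anyTo (suc k) = anyTo k ∨ (c k j ≡ᵇ v)

module BK (n m r : ℕ) (c : PP) where
  ignoredCol : ℕ → Bool
  ignoredCol j = colHas c (n + m) j r ∧ colHas c (n + m) j (r ∸ 1)

  -- entry (i,j) is a "free" r or r-1: not in an ignored column, and not a
  -- saturated r-1 (an r-1 in 1-indexed column n+m-r+1)
  free : ℕ → ℕ → Bool
  free i j = not (ignoredCol j)
             ∧ ((c i j ≡ᵇ r)
                ∨ ((c i j ≡ᵇ r ∸ 1) ∧ not (suc j ≡ᵇ n + m ∸ r + 1)))

  lRow : ℕ → ℕ
  lRow i = count n (λ j → free i j ∧ (c i j ≡ᵇ r ∸ 1))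

  rank : ℕ → ℕ → ℕ
  rank i j = count j (λ j' → free i j')

  -- the k free r's followed by l free (r-1)'s of each row are replaced by
  -- l r's followed by k (r-1)'s
  βc : PP
  βc i j = if free i j then (if rank i j <ᵇ lRow i then r else r ∸ 1) else c i j

β : (n m r : ℕ) → PP → PP
β n m r c = BK.βc n m r c

{-# OPTIONS --safe #-}
-- β_r only moves the free entries, and in a row with k free r's and l free
-- (r−1)'s it leaves l r's and k (r−1)'s.  So row by row #r(βc) and #(r−1)(c)
-- are both l plus the number of frozen (non-free) r's, resp. (r−1)'s, and
-- likewise with k for #r(c) and #(r−1)(βc).  A frozen r sits in an ignored
-- column; a frozen r−1 sits in an ignored column or is saturated, and since
-- columns are strict and column n+m−r+1 is bounded by r−1, the only possible
-- saturated r−1 is c_{1,n+m−r+1}.  Every ignored column holds exactly one r and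
-- one r−1, so the frozen (r−1)'s outnumber the frozen r's by
-- [c_{1,n+m−r+1} = r−1], which is exactly the k = r−1 term of the second sum
-- in Ū_r.  The terms k < r−1 of that sum read entries different from r, r−1,
-- which β_r does not touch.
module Submission where

open import Defs
open import Data.Bool using (Bool; true; false; if_then_else_; _∧_; _∨_; not; T)
open import Data.Bool.Properties
  using (∧-zeroʳ; ∧-identityʳ; ∧-comm; ∧-conicalˡ; ∧-conicalʳ)
open import Data.Nat
  using (ℕ; zero; suc; pred; _+_; _∸_; _⊓_; _≤_; _<_; _≡ᵇ_; _<ᵇ_; z≤n; s≤s)
open import Data.Nat.Properties
open import Algebra.Properties.CommutativeSemigroup +-commutativeSemigroup
  using (interchange; x∙yz≈xz∙y)
open import Data.Product using (_×_; _,_; ∃-syntax)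
open import Data.Sum using (_⊎_; inj₁; inj₂)
open import Data.Unit using (tt)
open import Function using (_∘_)
open import Relation.Binary.Definitions using (tri<; tri≈; tri>)
open import Relation.Binary.PropositionalEquality
open import Relation.Nullary.Decidable using (yes; no; dec-true; dec-false)
open import Relation.Nullary.Negation using (contradiction)
open ≡-Reasoning

indicator : Bool → ℕ
indicator b = if b then 1 else 0

≡ᵇ-true : ∀ {x y} → x ≡ y → (x ≡ᵇ y) ≡ true
≡ᵇ-true {x} {y} = dec-true (x ≟ y)

≡ᵇ-false : ∀ {x y} → x ≢ y → (x ≡ᵇ y) ≡ false
≡ᵇ-false {x} {y} = dec-false (x ≟ y)

≡ᵇ-sound : ∀ {x y} → (x ≡ᵇ y) ≡ true → x ≡ y
≡ᵇ-sound {x} {y} x≡ᵇy = ≡ᵇ⇒≡ x y (subst T (sym x≡ᵇy) tt)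

≡ᵇ-disjoint : ∀ x {a b} → a ≢ b → (x ≡ᵇ a) ∧ (x ≡ᵇ b) ≡ false
≡ᵇ-disjoint x {a} a≢b with x ≟ a
... | yes refl rewrite ≡ᵇ-false a≢b = ∧-zeroʳ _
... | no x≢a   rewrite ≡ᵇ-false x≢a = refl

if-≡ᵇ-then : ∀ {a b} → a ≢ b → ∀ B → ((if B then a else b) ≡ᵇ a) ≡ B
if-≡ᵇ-then {a} _   true  = ≡ᵇ-true {a} refl
if-≡ᵇ-then     a≢b false = ≡ᵇ-false (a≢b ∘ sym)

if-≡ᵇ-else : ∀ {a b} → a ≢ b → ∀ B → ((if B then a else b) ≡ᵇ b) ≡ not B
if-≡ᵇ-else         a≢b true  = ≡ᵇ-false a≢b
if-≡ᵇ-else {b = b} _   false = ≡ᵇ-true {b} refl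

if-≡ᵇ-neither : ∀ {a b v} → v ≢ a → v ≢ b → ∀ B → ((if B then a else b) ≡ᵇ v) ≡ false
if-≡ᵇ-neither v≢a v≢b true  = ≡ᵇ-false (v≢a ∘ sym)
if-≡ᵇ-neither v≢a v≢b false = ≡ᵇ-false (v≢b ∘ sym)

sumTo-cong : ∀ N {f g : ℕ → ℕ} → (∀ i → f i ≡ g i) → sumTo N f ≡ sumTo N g
sumTo-cong zero    f≗g = refl
sumTo-cong (suc N) f≗g = cong₂ _+_ (sumTo-cong N f≗g) (f≗g N)

sumTo-zero : ∀ N → sumTo N (λ _ → 0) ≡ 0
sumTo-zero zero    = refl
sumTo-zero (suc N) = cong (_+ 0) (sumTo-zero N)

sumTo-+ : ∀ N (f g : ℕ → ℕ) → sumTo N (λ i → f i + g i) ≡ sumTo N f + sumTo N g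
sumTo-+ zero    f g = refl
sumTo-+ (suc N) f g =
  trans (cong (_+ (f N + g N)) (sumTo-+ N f g)) (interchange (sumTo N f) (sumTo N g) (f N) (g N))

count-as-sumTo : ∀ N p → count N p ≡ sumTo N (λ j → indicator (p j))
count-as-sumTo zero    p = refl
count-as-sumTo (suc N) p = cong (_+ indicator (p N)) (count-as-sumTo N p)

sumTo-count-swap : ∀ N n (p : ℕ → ℕ → Bool) →
  sumTo N (λ i → count n (p i)) ≡ sumTo n (λ j → count N (λ i → p i j))
sumTo-count-swap zero    n p = sym (sumTo-zero n)
sumTo-count-swap (suc N) n p = begin
  sumTo N (λ i → count n (p i)) + count n (p N)
    ≡⟨ cong₂ _+_ (sumTo-count-swap N n p) (count-as-sumTo n (p N)) ⟩
  sumTo n (λ j → count N (λ i → p i j)) + sumTo n (λ j → indicator (p N j))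
    ≡⟨ sumTo-+ n _ _ ⟨
  sumTo n (λ j → count (suc N) (λ i → p i j)) ∎

count-cong : ∀ N {p q : ℕ → Bool} → (∀ j → j < N → p j ≡ q j) → count N p ≡ count N q
count-cong zero    p≗q = refl
count-cong (suc N) p≗q =
  cong₂ _+_ (count-cong N (λ j j<N → p≗q j (m<n⇒m<1+n j<N))) (cong indicator (p≗q N (n<1+n N)))

count-zero : ∀ N {p} → (∀ j → j < N → p j ≡ false) → count N p ≡ 0
count-zero zero    p≡false = refl
count-zero (suc N) p≡false =
  cong₂ _+_ (count-zero N (λ j j<N → p≡false j (m<n⇒m<1+n j<N))) (cong indicator (p≡false N (n<1+n N)))

count-singleton : ∀ N a {p} →
  (∀ j → j < N → j ≢ a → p j ≡ false) → (N ≤ a → p a ≡ false) → count N p ≡ indicator (p a)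
count-singleton zero    a     off out = cong indicator (sym (out z≤n))
count-singleton (suc N) a {p} off out with N ≟ a
... | yes refl =
  cong (_+ indicator (p N)) (count-zero N (λ j j<N → off j (m<n⇒m<1+n j<N) (<⇒≢ j<N)))
... | no N≢a = begin
  count N p + indicator (p N)
    ≡⟨ cong₂ _+_ (count-singleton N a (λ j j<N → off j (m<n⇒m<1+n j<N))
                                      (λ N≤a → out (≤∧≢⇒< N≤a N≢a)))
                 (cong indicator (off N (n<1+n N) N≢a)) ⟩
  indicator (p a) + 0
    ≡⟨ +-identityʳ _ ⟩
  indicator (p a) ∎

indicator-split : ∀ b c → indicator b ≡ indicator (b ∧ c) + indicator (b ∧ not c)
indicator-split false c     = refl
indicator-split true  true  = refl
indicator-split true  false = refl

count-partition : ∀ N (p q : ℕ → Bool) →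
  count N p ≡ count N (λ j → p j ∧ q j) + count N (λ j → p j ∧ not (q j))
count-partition zero    p q = refl
count-partition (suc N) p q =
  trans (cong₂ _+_ (count-partition N p q) (indicator-split (p N) (q N)))
        (interchange (count N p∧q) (count N p∧¬q) (indicator (p∧q N)) (indicator (p∧¬q N)))
  where
  p∧q p∧¬q : ℕ → Bool
  p∧q  j = p j ∧ q j
  p∧¬q j = p j ∧ not (q j)

⊓-+1 : ∀ L x → L ⊓ (x + 1) ≡ L ⊓ x + indicator (x <ᵇ L)
⊓-+1 zero    x       = refl
⊓-+1 (suc L) zero    = cong suc (⊓-zeroʳ L)
⊓-+1 (suc L) (suc x) = cong suc (⊓-+1 L x)

count-rank : ∀ N p L → count N (λ j → p j ∧ (count j p <ᵇ L)) ≡ L ⊓ count N p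
count-rank zero    p L = sym (⊓-zeroʳ L)
count-rank (suc N) p L with p N
... | false = trans (+-identityʳ _) (trans (count-rank N p L) (cong (L ⊓_) (sym (+-identityʳ _))))
... | true  = trans (cong (_+ indicator (count N p <ᵇ L)) (count-rank N p L))
                    (sym (⊓-+1 L (count N p)))

-- `colHas` scans its column with a local function that cannot be referred to;
-- `colHasUpTo` names it, the meta being solved by unification in `colHas-suc`.
mutual
  colHasUpTo : PP → ℕ → ℕ → ℕ → ℕ → Bool
  colHasUpTo c N j v k = _

  colHas-suc : ∀ c K j v → colHas c (suc K) j v ≡ colHasUpTo c (suc K) j v K ∨ (c K j ≡ᵇ v)
  colHas-suc c K j v with suc K
  ... | N = refl

colHas-unfold : ∀ c N j v → colHas c N j v ≡ colHasUpTo c N j v N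
colHas-unfold c zero    j v = refl
colHas-unfold c (suc K) j v = colHas-suc c K j v

colHasUpTo-sound : ∀ c N j v k → colHasUpTo c N j v k ≡ true → ∃[ i ] i < k × c i j ≡ v
colHasUpTo-sound c N j v (suc k) has with colHasUpTo c N j v k in hasₖ
... | true  = let i , i<k , cij≡v = colHasUpTo-sound c N j v k hasₖ in i , m<n⇒m<1+n i<k , cij≡v
... | false = k , n<1+n k , ≡ᵇ-sound has

colHas-sound : ∀ c N j v → colHas c N j v ≡ true → ∃[ i ] i < N × c i j ≡ v
colHas-sound c N j v has = colHasUpTo-sound c N j v N (trans (sym (colHas-unfold c N j v)) has)

module _ {n m : ℕ} {c : PP} (isC : IsC n m c) where
  open IsC isC

  column-decreasing : ∀ j {i k} → i < k → c k j ≢ 0 → c k j < c i j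
  column-decreasing j {i} {suc k} (s≤s i≤k) ck≢0 with colStrict k j
  ... | inj₁ ck≡0 = contradiction ck≡0 ck≢0
  ... | inj₂ lt with m≤n⇒m<n∨m≡n i≤k
  ...   | inj₂ refl = lt
  ...   | inj₁ i<k  = <-trans lt (column-decreasing j i<k (m<n⇒n≢0 lt))

  column-injective : ∀ j {i k} → c i j ≡ c k j → c i j ≢ 0 → i ≡ k
  column-injective j {i} {k} eq ci≢0 with <-cmp i k
  ... | tri< i<k _ _ = contradiction (sym eq) (<⇒≢ (column-decreasing j i<k (ci≢0 ∘ trans eq)))
  ... | tri≈ _ i≡k _ = i≡k
  ... | tri> _ _ k<i = contradiction eq (<⇒≢ (column-decreasing j k<i ci≢0))

  count-column : ∀ N j v → v ≢ 0 → colHas c N j v ≡ true →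
    count N (λ i → c i j ≡ᵇ v) ≡ 1
  count-column N j v v≢0 has with colHas-sound c N j v has
  ... | a , a<N , caj≡v =
    trans (count-singleton N a off (λ N≤a → contradiction a<N (≤⇒≯ N≤a)))
          (cong indicator (≡ᵇ-true caj≡v))
    where
    off : ∀ i → i < N → i ≢ a → (c i j ≡ᵇ v) ≡ false
    off i _ i≢a = ≡ᵇ-false λ cij≡v →
      i≢a (column-injective j (trans cij≡v (sym caj≡v)) (v≢0 ∘ trans (sym cij≡v)))

-- `BK.free i j` unfolds to
-- `freeCell (ignoredCol j) (c i j ≡ᵇ r) (c i j ≡ᵇ r ∸ 1) (saturated j)`.
freeCell : (ignored isR isS saturated : Bool) → Bool
freeCell I R S T = not I ∧ (R ∨ (S ∧ not T))

freeCell⇒isR⊎isS : ∀ I R S T → freeCell I R S T ≡ true → R ≡ true ⊎ S ≡ true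
freeCell⇒isR⊎isS I     true  S     T _ = inj₁ refl
freeCell⇒isR⊎isS I     false true  T _ = inj₂ refl
freeCell⇒isR⊎isS true  false false T ()
freeCell⇒isR⊎isS false false false T ()

freeCell-saturated : ∀ I S → freeCell I false S true ≡ false
freeCell-saturated true  S     = refl
freeCell-saturated false false = refl
freeCell-saturated false true  = refl

freeCell-∧-not-isR : ∀ I R S T → R ∧ S ≡ false →
  freeCell I R S T ∧ not R ≡ freeCell I R S T ∧ S
freeCell-∧-not-isR true  R     S     T _  = refl
freeCell-∧-not-isR false true  false T _  = refl
freeCell-∧-not-isR false true  true  T ()
freeCell-∧-not-isR false false false T _  = refl
freeCell-∧-not-isR false false true  T _  = refl

isR-∧-frozen : ∀ I R S T → R ∧ not (freeCell I R S T) ≡ R ∧ I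
isR-∧-frozen I     false S T = refl
isR-∧-frozen true  true  S T = refl
isR-∧-frozen false true  S T = refl

isS-∧-frozen-∧-ignored : ∀ I R S T → (S ∧ not (freeCell I R S T)) ∧ I ≡ S ∧ I
isS-∧-frozen-∧-ignored I     R false T = refl
isS-∧-frozen-∧-ignored true  R true  T = refl
isS-∧-frozen-∧-ignored false R true  T = ∧-zeroʳ _

isS-∧-frozen-∧-unignored : ∀ I R S T → R ∧ S ≡ false → T ∧ I ≡ false →
  (S ∧ not (freeCell I R S T)) ∧ not I ≡ S ∧ T
isS-∧-frozen-∧-unignored I     R     false T     _  _  = refl
isS-∧-frozen-∧-unignored true  R     true  false _  _  = refl
isS-∧-frozen-∧-unignored true  R     true  true  _  ()
isS-∧-frozen-∧-unignored false true  true  T     () _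
isS-∧-frozen-∧-unignored false false true  false _  _  = refl
isS-∧-frozen-∧-unignored false false true  true  _  _  = refl

module TwistedBenderKnuth
  (n m s : ℕ) (c : PP) (isC : IsC n m c) (s≢0 : s ≢ 0) (r≤N : suc s ≤ n + m) where
  open IsC isC
  open BK n m (suc s) c

  r N j₀ : ℕ
  r  = suc s
  N  = n + m
  -- the paper's column n+m−r+1, where an r−1 is saturated
  j₀ = n + m ∸ r

  saturated : ℕ → Bool
  saturated j = suc j ≡ᵇ n + m ∸ r + 1

  kRow : ℕ → ℕ
  kRow i = count n (λ j → free i j ∧ (c i j ≡ᵇ r))

  frozen : ℕ → ℕ → ℕ
  frozen v i = count n (λ j → (c i j ≡ᵇ v) ∧ not (free i j))

  -- `Ubar n m v x` is definitionally `cells v x + corner v x`.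
  cells : ℕ → PP → ℕ
  cells v x = sumTo N (λ i → count n (λ j → x i j ≡ᵇ v))

  corner : ℕ → PP → ℕ
  corner v x = count v (λ k → not (k ≡ᵇ 0) ∧ (x 0 (n + m ∸ suc k) ≡ᵇ k))

  r≢s : r ≢ s
  r≢s = >⇒≢ (n<1+n s)

  r-∧-s : ∀ i j → (c i j ≡ᵇ r) ∧ (c i j ≡ᵇ s) ≡ false
  r-∧-s i j = ≡ᵇ-disjoint (c i j) r≢s

  β-frozen : ∀ {i j} → free i j ≡ false → βc i j ≡ c i j
  β-frozen notFree rewrite notFree = refl

  βr-∧-free : ∀ i j → (βc i j ≡ᵇ r) ∧ free i j ≡ free i j ∧ (rank i j <ᵇ lRow i)
  βr-∧-free i j with free i j
  ... | false = ∧-zeroʳ _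
  ... | true  = trans (∧-identityʳ _) (if-≡ᵇ-then r≢s _)

  βs-∧-free : ∀ i j → (βc i j ≡ᵇ s) ∧ free i j ≡ free i j ∧ not (rank i j <ᵇ lRow i)
  βs-∧-free i j with free i j
  ... | false = ∧-zeroʳ _
  ... | true  = trans (∧-identityʳ _) (if-≡ᵇ-else r≢s _)

  β-∧-frozen : ∀ v i j → (βc i j ≡ᵇ v) ∧ not (free i j) ≡ (c i j ≡ᵇ v) ∧ not (free i j)
  β-∧-frozen v i j with free i j
  ... | false = refl
  ... | true  = trans (∧-zeroʳ _) (sym (∧-zeroʳ _))

  β-≡ᵇ-other : ∀ {v} i j → v ≢ r → v ≢ s → (βc i j ≡ᵇ v) ≡ (c i j ≡ᵇ v)
  β-≡ᵇ-other {v} i j v≢r v≢s with free i j in isFree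
  ... | false = refl
  ... | true = trans (if-≡ᵇ-neither v≢r v≢s (rank i j <ᵇ lRow i)) (sym (≡ᵇ-false {c i j} c≢v))
    where
    c≢v : c i j ≢ v
    c≢v cij≡v with freeCell⇒isR⊎isS (ignoredCol j) (c i j ≡ᵇ r) (c i j ≡ᵇ s) (saturated j) isFree
    ... | inj₁ isR = v≢r (trans (sym cij≡v) (≡ᵇ-sound isR))
    ... | inj₂ isS = v≢s (trans (sym cij≡v) (≡ᵇ-sound isS))

  free-count : ∀ i → count n (free i) ≡ kRow i + lRow i
  free-count i = trans (count-partition n (free i) (λ j → c i j ≡ᵇ r))
    (cong (kRow i +_) (count-cong n λ j _ →
      freeCell-∧-not-isR (ignoredCol j) (c i j ≡ᵇ r) (c i j ≡ᵇ s) (saturated j) (r-∧-s i j)))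

  rank-below : ∀ i → count n (λ j → free i j ∧ (rank i j <ᵇ lRow i)) ≡ lRow i
  rank-below i = trans (count-rank n (free i) (lRow i))
    (m≤n⇒m⊓n≡m (subst (lRow i ≤_) (sym (free-count i)) (m≤n+m (lRow i) (kRow i))))

  rank-above : ∀ i → count n (λ j → free i j ∧ not (rank i j <ᵇ lRow i)) ≡ kRow i
  rank-above i = +-cancelˡ-≡ (lRow i) _ _ (begin
    lRow i + above        ≡⟨ cong (_+ above) (rank-below i) ⟨
    below + above         ≡⟨ count-partition n (free i) (λ j → rank i j <ᵇ lRow i) ⟨
    count n (free i)      ≡⟨ free-count i ⟩
    kRow i + lRow i       ≡⟨ +-comm (kRow i) (lRow i) ⟩
    lRow i + kRow i       ∎)
    where
    below above : ℕ
    below = count n (λ j → free i j ∧ (rank i j <ᵇ lRow i))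
    above = count n (λ j → free i j ∧ not (rank i j <ᵇ lRow i))

  row-split : ∀ (x : PP) v i {a} →
    count n (λ j → (x i j ≡ᵇ v) ∧ free i j) ≡ a →
    count n (λ j → (x i j ≡ᵇ v) ∧ not (free i j)) ≡ frozen v i →
    count n (λ j → x i j ≡ᵇ v) ≡ a + frozen v i
  row-split x v i freePart frozenPart =
    trans (count-partition n _ (free i)) (cong₂ _+_ freePart frozenPart)

  row-βr : ∀ i → count n (λ j → βc i j ≡ᵇ r) ≡ lRow i + frozen r i
  row-βr i = row-split βc r i (trans (count-cong n (λ j _ → βr-∧-free i j)) (rank-below i))
                              (count-cong n (λ j _ → β-∧-frozen r i j))

  row-βs : ∀ i → count n (λ j → βc i j ≡ᵇ s) ≡ kRow i + frozen s i
  row-βs i = row-split βc s i (trans (count-cong n (λ j _ → βs-∧-free i j)) (rank-above i))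
                              (count-cong n (λ j _ → β-∧-frozen s i j))

  row-r : ∀ i → count n (λ j → c i j ≡ᵇ r) ≡ kRow i + frozen r i
  row-r i = row-split c r i (count-cong n (λ j _ → ∧-comm (c i j ≡ᵇ r) (free i j))) refl

  row-s : ∀ i → count n (λ j → c i j ≡ᵇ s) ≡ lRow i + frozen s i
  row-s i = row-split c s i (count-cong n (λ j _ → ∧-comm (c i j ≡ᵇ s) (free i j))) refl

  column-j₀-bound : ∀ i → c i j₀ ≤ s
  column-j₀-bound i = subst (c i j₀ ≤_) N∸suc-j₀ (bound i j₀)
    where
    N∸suc-j₀ : N ∸ suc j₀ ≡ s
    N∸suc-j₀ = trans (sym (pred[m∸n]≡m∸[1+n] N j₀)) (cong pred (m∸[m∸n]≡n r≤N))

  column-j₀-has-no-r : ∀ i → c i j₀ ≢ r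
  column-j₀-has-no-r i cij₀≡r = 1+n≰n (subst (_≤ s) cij₀≡r (column-j₀-bound i))

  column-j₀-has-s-only-in-row-0 : ∀ {i} → 0 < i → c i j₀ ≢ s
  column-j₀-has-s-only-in-row-0 0<i cij₀≡s = <-irrefl cij₀≡s
    (<-≤-trans (column-decreasing isC j₀ 0<i (s≢0 ∘ trans (sym cij₀≡s))) (column-j₀-bound 0))

  saturated-j₀ : saturated j₀ ≡ true
  saturated-j₀ = ≡ᵇ-true (+-comm 1 j₀)

  saturated⇒j₀ : ∀ {j} → saturated j ≡ true → j ≡ j₀
  saturated⇒j₀ sat = suc-injective (trans (≡ᵇ-sound sat) (+-comm j₀ 1))

  column-j₀-not-ignored : ignoredCol j₀ ≡ false
  column-j₀-not-ignored with ignoredCol j₀ in ignored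
  ... | false = refl
  ... | true  = let i , _ , cij₀≡r = colHas-sound c N j₀ r (∧-conicalˡ _ _ ignored)
                in contradiction cij₀≡r (column-j₀-has-no-r i)

  saturated-∧-ignored : ∀ j → saturated j ∧ ignoredCol j ≡ false
  saturated-∧-ignored j with saturated j in sat
  ... | false = refl
  ... | true  rewrite saturated⇒j₀ sat = column-j₀-not-ignored

  β-column-j₀ : ∀ i → βc i j₀ ≡ c i j₀
  β-column-j₀ i = β-frozen (trans
    (cong₂ (λ R T → freeCell (ignoredCol j₀) R (c i j₀ ≡ᵇ s) T)
           (≡ᵇ-false (column-j₀-has-no-r i)) saturated-j₀)
    (freeCell-saturated (ignoredCol j₀) (c i j₀ ≡ᵇ s)))

  frozen-r : ∀ i → frozen r i ≡ count n (λ j → (c i j ≡ᵇ r) ∧ ignoredCol j)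
  frozen-r i = count-cong n λ j _ →
    isR-∧-frozen (ignoredCol j) (c i j ≡ᵇ r) (c i j ≡ᵇ s) (saturated j)

  frozen-s : ∀ i → frozen s i ≡
    count n (λ j → (c i j ≡ᵇ s) ∧ ignoredCol j) + count n (λ j → (c i j ≡ᵇ s) ∧ saturated j)
  frozen-s i = trans (count-partition n _ ignoredCol) (cong₂ _+_
    (count-cong n λ j _ →
      isS-∧-frozen-∧-ignored (ignoredCol j) (c i j ≡ᵇ r) (c i j ≡ᵇ s) (saturated j))
    (count-cong n λ j _ →
      isS-∧-frozen-∧-unignored (ignoredCol j) (c i j ≡ᵇ r) (c i j ≡ᵇ s) (saturated j)
                               (r-∧-s i j) (saturated-∧-ignored j)))

  ignored-total : ∀ v → v ≢ 0 → (∀ {j} → ignoredCol j ≡ true → colHas c N j v ≡ true) →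
    sumTo N (λ i → count n (λ j → (c i j ≡ᵇ v) ∧ ignoredCol j)) ≡ count n ignoredCol
  ignored-total v v≢0 has = begin
    sumTo N (λ i → count n (λ j → (c i j ≡ᵇ v) ∧ ignoredCol j))
      ≡⟨ sumTo-count-swap N n _ ⟩
    sumTo n (λ j → count N (λ i → (c i j ≡ᵇ v) ∧ ignoredCol j))
      ≡⟨ sumTo-cong n column ⟩
    sumTo n (λ j → indicator (ignoredCol j))
      ≡⟨ count-as-sumTo n ignoredCol ⟨
    count n ignoredCol ∎
    where
    column : ∀ j → count N (λ i → (c i j ≡ᵇ v) ∧ ignoredCol j) ≡ indicator (ignoredCol j)
    column j with ignoredCol j in ignored
    ... | false = count-zero N (λ i _ → ∧-zeroʳ _)
    ... | true  = trans (count-cong N (λ i _ → ∧-identityʳ _))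
                        (count-column isC N j v v≢0 (has ignored))

  saturated-total :
    sumTo N (λ i → count n (λ j → (c i j ≡ᵇ s) ∧ saturated j)) ≡ indicator (c 0 j₀ ≡ᵇ s)
  saturated-total = begin
    sumTo N (λ i → count n (λ j → (c i j ≡ᵇ s) ∧ saturated j))
      ≡⟨ sumTo-cong N row ⟩
    sumTo N (λ i → indicator (c i j₀ ≡ᵇ s))
      ≡⟨ count-as-sumTo N _ ⟨
    count N (λ i → c i j₀ ≡ᵇ s)
      ≡⟨ count-singleton N 0 (λ i _ i≢0 → ≡ᵇ-false (column-j₀-has-s-only-in-row-0 (n≢0⇒n>0 i≢0)))
                             (λ N≤0 → contradiction (≤-trans r≤N N≤0) λ ()) ⟩
    indicator (c 0 j₀ ≡ᵇ s) ∎
    where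
    row : ∀ i → count n (λ j → (c i j ≡ᵇ s) ∧ saturated j) ≡ indicator (c i j₀ ≡ᵇ s)
    row i = trans (count-singleton n j₀ off outside)
                  (cong indicator (trans (cong ((c i j₀ ≡ᵇ s) ∧_) saturated-j₀) (∧-identityʳ _)))
      where
      off : ∀ j → j < n → j ≢ j₀ → (c i j ≡ᵇ s) ∧ saturated j ≡ false
      off j _ j≢j₀ with saturated j in sat
      ... | false = ∧-zeroʳ _
      ... | true  = contradiction (saturated⇒j₀ sat) j≢j₀
      outside : n ≤ j₀ → (c i j₀ ≡ᵇ s) ∧ saturated j₀ ≡ false
      outside n≤j₀ rewrite atMostNCols i j₀ n≤j₀ | ≡ᵇ-false {0} {s} (s≢0 ∘ sym) = refl

  balance : sumTo N (frozen s) ≡ sumTo N (frozen r) + indicator (c 0 j₀ ≡ᵇ s)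
  balance = begin
    sumTo N (frozen s)
      ≡⟨ trans (sumTo-cong N frozen-s) (sumTo-+ N _ _) ⟩
    sumTo N (λ i → count n (λ j → (c i j ≡ᵇ s) ∧ ignoredCol j))
      + sumTo N (λ i → count n (λ j → (c i j ≡ᵇ s) ∧ saturated j))
      ≡⟨ cong₂ _+_ (ignored-total s s≢0 (∧-conicalʳ _ _)) saturated-total ⟩
    count n ignoredCol + indicator (c 0 j₀ ≡ᵇ s)
      ≡⟨ cong (_+ indicator (c 0 j₀ ≡ᵇ s))
              (trans (sumTo-cong N frozen-r) (ignored-total r (λ ()) (∧-conicalˡ _ _))) ⟨
    sumTo N (frozen r) + indicator (c 0 j₀ ≡ᵇ s) ∎

  cells-exchange : ∀ (x y : PP) (k : ℕ → ℕ) →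
    (∀ i → count n (λ j → x i j ≡ᵇ r) ≡ k i + frozen r i) →
    (∀ i → count n (λ j → y i j ≡ᵇ s) ≡ k i + frozen s i) →
    cells r x + indicator (c 0 j₀ ≡ᵇ s) ≡ cells s y
  cells-exchange x y k rowˣ rowʸ = begin
    cells r x + indicator (c 0 j₀ ≡ᵇ s)
      ≡⟨ cong (_+ _) (trans (sumTo-cong N rowˣ) (sumTo-+ N k (frozen r))) ⟩
    sumTo N k + sumTo N (frozen r) + indicator (c 0 j₀ ≡ᵇ s)
      ≡⟨ +-assoc (sumTo N k) _ _ ⟩
    sumTo N k + (sumTo N (frozen r) + indicator (c 0 j₀ ≡ᵇ s))
      ≡⟨ cong (sumTo N k +_) balance ⟨
    sumTo N k + sumTo N (frozen s)
      ≡⟨ trans (sumTo-cong N rowʸ) (sumTo-+ N k (frozen s)) ⟨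
    cells s y ∎

  corner-β : corner s βc ≡ corner s c
  corner-β = count-cong s λ k k<s →
    cong (not (k ≡ᵇ 0) ∧_) (β-≡ᵇ-other 0 (n + m ∸ suc k) (<⇒≢ (m<n⇒m<1+n k<s)) (<⇒≢ k<s))

  Ubar-r : ∀ x → x 0 j₀ ≡ c 0 j₀ →
    Ubar n m r x ≡ cells r x + indicator (c 0 j₀ ≡ᵇ s) + corner s x
  Ubar-r x x₀≡c₀ = begin
    cells r x + corner r x
      ≡⟨ cong (λ b → cells r x + (corner s x + indicator (not b ∧ (x 0 j₀ ≡ᵇ s)))) (≡ᵇ-false s≢0) ⟩
    cells r x + (corner s x + indicator (x 0 j₀ ≡ᵇ s))
      ≡⟨ x∙yz≈xz∙y (cells r x) _ _ ⟩
    cells r x + indicator (x 0 j₀ ≡ᵇ s) + corner s x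
      ≡⟨ cong (λ y → cells r x + indicator (y ≡ᵇ s) + corner s x) x₀≡c₀ ⟩
    cells r x + indicator (c 0 j₀ ≡ᵇ s) + corner s x ∎

  Ubar-β-r : Ubar n m r βc ≡ Ubar n m s c
  Ubar-β-r = trans (Ubar-r βc (β-column-j₀ 0))
                   (cong₂ _+_ (cells-exchange βc c lRow row-βr row-s) corner-β)

  Ubar-r-β : Ubar n m r c ≡ Ubar n m s βc
  Ubar-r-β = trans (Ubar-r c refl)
                   (cong₂ _+_ (cells-exchange c βc kRow row-r row-βs) (sym corner-β))

mainTheorem2 : (m n r : ℕ) → 1 ≤ n → 2 ≤ r → r ≤ n + m →
    (c : PP) → IsC n m c →
    (Ubar n m r (β n m r c) ≡ Ubar n m (r ∸ 1) c)
    × (Ubar n m r c ≡ Ubar n m (r ∸ 1) (β n m r c))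
mainTheorem2 m n (suc s) _ (s≤s 0<s) r≤N c isC = Ubar-β-r , Ubar-r-β
  where open TwistedBenderKnuth n m s c isC (m<n⇒n≢0 0<s) r≤N
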